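{- Let $g\ge 0$ be an integer and let $\Lambda=\{0,g+1,g+2,\dots\}=\{0\}\cup\{i\in\mathbb{N}_0: i\ge g+1\}$. Then the minimal generating set of $\Lambda$ is $\{g+1,g+2,\dots,2g+1\}$, and: (1) $\Lambda\setminus\{g+1\}$ has exactly $g+2$ minimal generators larger than its Frobenius number; (2) if $g\ge 1$, $\Lambda\setminus\{g+2\}$ has exactly $g$ minimal generators larger than its Frobenius number; (3) for every integer $r$ with $2<r\le g+1$, $\Lambda\setminus\{g+r\}$ has exactly $g-r+1$ minimal generators larger than its Frobenius number.
   Context: A numerical semigroup is a subset $\Lambda\subseteq\mathbb{N}_0$ containing $0$, closed under addition, with finite complement in $\mathbb{N}_0$. Its Frobenius number is the largest element of $\mathbb{N}_0\setminus\Lambda$. A minimal generator of $\Lambda$ is a nonzero element of $\Lambda$ that is not the sum of two nonzero elements of $\Lambda$. Removing a minimal generator from a numerical semigroup yields a numerical semigroup. -}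

module Defs where

open import Data.Nat using (ℕ; zero; suc; _+_; _≤_; _<_)
open import Data.Product using (Σ; ∃; _×_; _,_)
open import Data.Empty using (⊥)
open import Data.Sum using (_⊎_)
open import Data.List using (List; length)
open import Data.List.Membership.Propositional using (_∈_)
open import Data.List.Relation.Unary.Unique.Propositional using (Unique)
open import Relation.Nullary using (¬_)
open import Relation.Binary.PropositionalEquality using (_≡_; _≢_)
open import Function.Bundles using (_⇔_)

Subset : Set₁
Subset = ℕ → Set

-- Numerical semigroup: contains 0, closed under addition, finite complement
-- (finite complement ⇔ there is a bound N beyond which every number belongs).
record IsNumericalSemigroup (Λ : Subset) : Set where
  field
    zero∈  : Λ 0
    +-closed : ∀ {a b} → Λ a → Λ b → Λ (a + b)
    cofinite : ∃ λ N → ∀ n → N ≤ n → Λ n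

IsFrobenius : Subset → ℕ → Set
IsFrobenius Λ F = ¬ Λ F × (∀ n → ¬ Λ n → n ≤ F)

IsMinimalGenerator : Subset → ℕ → Set
IsMinimalGenerator Λ x =
  x ≢ 0 × Λ x ×
  (∀ a b → a ≢ 0 → b ≢ 0 → Λ a → Λ b → a + b ≢ x)

HasExactly : (ℕ → Set) → ℕ → Set
HasExactly P k = Σ (List ℕ) λ xs → Unique xs × length xs ≡ k × (∀ x → (x ∈ xs) ⇔ P x)

remove : Subset → ℕ → Subset
remove Λ m n = Λ n × n ≢ m

MinGensAboveFrobenius : Subset → ℕ → Set
MinGensAboveFrobenius Λ k =
  Σ ℕ λ F → IsFrobenius Λ F × HasExactly (λ x → IsMinimalGenerator Λ x × F < x) k

ordinary : ℕ → Subset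
ordinary g n = n ≡ 0 ⊎ (suc g ≤ n)

module Submission where

-- Every nonzero element of ordinary g is at least g + 1, so everything below 2(g + 1) is
-- indecomposable, while every x ≥ 2(g + 1) splits as (g + 1) + (x − (g + 1)). After
-- removing m ≥ g + 2 this splitting only fails for x = (g + 1) + m, which is still
-- decomposable as (g + 2) + (m − 1) unless m = g + 2. Removing g + 1 just gives
-- ordinary (g + 1).

open import Defs
open import Data.Nat using (ℕ; suc; _+_; _∸_; _≤_; _<_; s≤s; _≟_; _<?_; _≤?_)
open import Data.Nat.Properties
open import Data.Product using (_×_; _,_; proj₁)
open import Data.Sum using (_⊎_; inj₁; inj₂)
open import Data.Empty using (⊥-elim)
open import Data.List using (_∷_; applyUpTo)
open import Data.List.Membership.Propositional using (_∈_)
open import Data.List.Membership.Propositional.Properties using (∈-applyUpTo⁺; ∈-applyUpTo⁻)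
open import Data.List.Properties using (length-applyUpTo)
open import Data.List.Relation.Unary.Any using (here; there)
open import Data.List.Relation.Unary.All as All using ()
open import Data.List.Relation.Unary.AllPairs using (_∷_)
open import Data.List.Relation.Unary.Unique.Propositional.Properties using (applyUpTo⁺₁)
open import Relation.Nullary using (¬_; yes; no)
open import Relation.Binary.PropositionalEquality
open import Function using (_∘_; id)
open import Function.Properties.Equivalence using () renaming (sym to ⇔-sym; trans to ⇔-trans; refl to ⇔-refl)
open import Data.Product.Function.NonDependent.Propositional using (_×-⇔_)
open import Function.Bundles using (_⇔_; mk⇔; Equivalence)

HasExactly-cong : ∀ {P Q : ℕ → Set} {k} → (∀ x → P x ⇔ Q x) → HasExactly P k → HasExactly Q k
HasExactly-cong P⇔Q (xs , unique , len , ∈⇔P) =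
  xs , unique , len , λ x → mk⇔ (to (P⇔Q x) ∘ to (∈⇔P x)) (from (∈⇔P x) ∘ from (P⇔Q x))
  where open Equivalence

interval-HasExactly : ∀ lo hi → HasExactly (λ x → lo ≤ x × x < hi) (hi ∸ lo)
interval-HasExactly lo hi =
  applyUpTo (lo +_) (hi ∸ lo) ,
  applyUpTo⁺₁ (lo +_) (hi ∸ lo) (λ i<j _ → <⇒≢ (+-monoʳ-< lo i<j)) ,
  length-applyUpTo (lo +_) (hi ∸ lo) ,
  λ x → mk⇔ to from
  where
  to : ∀ {x} → x ∈ applyUpTo (lo +_) (hi ∸ lo) → lo ≤ x × x < hi
  to x∈ with i , i<k , refl ← ∈-applyUpTo⁻ (lo +_) x∈ =
    m≤m+n lo i , subst (lo + i <_) (m+[n∸m]≡n lo≤hi) (+-monoʳ-< lo i<k)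
    where
    lo≤hi : lo ≤ hi
    lo≤hi = <⇒≤ (m∸n≢0⇒n<m (m<n⇒n≢0 i<k))
  from : ∀ {x} → lo ≤ x × x < hi → x ∈ applyUpTo (lo +_) (hi ∸ lo)
  from (lo≤x , x<hi) = subst (_∈ _) (m+[n∸m]≡n lo≤x) (∈-applyUpTo⁺ (lo +_) (∸-monoˡ-< x<hi lo≤x))

HasExactly-∷ : ∀ {P : ℕ → Set} {k e} → ¬ P e → HasExactly P k → HasExactly (λ x → x ≡ e ⊎ P x) (suc k)
HasExactly-∷ {P} {e = e} ¬Pe (xs , unique , len , ∈⇔P) =
  e ∷ xs , All.tabulate e∉xs ∷ unique , cong suc len , λ x → mk⇔ to′ from′
  where
  open Equivalence
  e∉xs : ∀ {x} → x ∈ xs → e ≢ x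
  e∉xs x∈ refl = ¬Pe (to (∈⇔P e) x∈)
  to′ : ∀ {x} → x ∈ e ∷ xs → x ≡ e ⊎ P x
  to′ (here x≡e) = inj₁ x≡e
  to′ (there x∈) = inj₂ (to (∈⇔P _) x∈)
  from′ : ∀ {x} → x ≡ e ⊎ P x → x ∈ e ∷ xs
  from′ (inj₁ x≡e) = here x≡e
  from′ (inj₂ Px) = there (from (∈⇔P _) Px)

minGensAboveFrobenius-intro : ∀ {Λ : Subset} {F k} {Q : ℕ → Set} → IsFrobenius Λ F →
  (∀ x → (IsMinimalGenerator Λ x × F < x) ⇔ Q x) → HasExactly Q k → MinGensAboveFrobenius Λ k
minGensAboveFrobenius-intro isFrobenius P⇔Q hasExactly =
  _ , isFrobenius , HasExactly-cong (λ x → ⇔-sym (P⇔Q x)) hasExactly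

sum⇒¬isMinimalGenerator : ∀ {Λ : Subset} {a b} → a ≢ 0 → b ≢ 0 → Λ a → Λ b →
  ¬ IsMinimalGenerator Λ (a + b)
sum⇒¬isMinimalGenerator a≢0 b≢0 a∈ b∈ (_ , _ , indecomposable) =
  indecomposable _ _ a≢0 b≢0 a∈ b∈ refl

isMinimalGenerator-resp : ∀ {Λ Λ′ : Subset} → (∀ n → Λ n ⇔ Λ′ n) →
  ∀ {x} → IsMinimalGenerator Λ x → IsMinimalGenerator Λ′ x
isMinimalGenerator-resp Λ⇔Λ′ (x≢0 , x∈ , indecomposable) =
  x≢0 , to (Λ⇔Λ′ _) x∈ ,
  λ a b a≢0 b≢0 a∈ b∈ → indecomposable a b a≢0 b≢0 (from (Λ⇔Λ′ a) a∈) (from (Λ⇔Λ′ b) b∈)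
  where open Equivalence

ordinary-isNumericalSemigroup : ∀ g → IsNumericalSemigroup (ordinary g)
ordinary-isNumericalSemigroup g = record
  { zero∈ = inj₁ refl ; +-closed = +-closed ; cofinite = suc g , λ _ → inj₂ }
  where
  +-closed : ∀ {a b} → ordinary g a → ordinary g b → ordinary g (a + b)
  +-closed (inj₁ refl) b∈ = b∈
  +-closed {a} {b} (inj₂ g<a) _ = inj₂ (≤-trans g<a (m≤m+n a b))

ordinary-nonzero⇒> : ∀ {g a} → a ≢ 0 → ordinary g a → g < a
ordinary-nonzero⇒> a≢0 (inj₁ a≡0) = ⊥-elim (a≢0 a≡0)
ordinary-nonzero⇒> _   (inj₂ g<a) = g<a

<2[1+g]⇒isMinimalGenerator : ∀ {g} {Λ : Subset} → (∀ {n} → Λ n → ordinary g n) →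
  ∀ {x} → x ≢ 0 → Λ x → x < suc g + suc g → IsMinimalGenerator Λ x
<2[1+g]⇒isMinimalGenerator Λ⊆ x≢0 x∈ x<2[1+g] =
  x≢0 , x∈ , λ a b a≢0 b≢0 a∈ b∈ a+b≡x →
    <⇒≱ x<2[1+g] (subst (_ ≤_) a+b≡x
      (+-mono-≤ (ordinary-nonzero⇒> a≢0 (Λ⊆ a∈)) (ordinary-nonzero⇒> b≢0 (Λ⊆ b∈))))

1+g+rest⇒¬isMinimalGenerator : ∀ {g} {Λ : Subset} {x} → suc g + suc g ≤ x →
  Λ (suc g) → Λ (x ∸ suc g) → ¬ IsMinimalGenerator Λ x
1+g+rest⇒¬isMinimalGenerator {g} {Λ} {x} 2[1+g]≤x 1+g∈ rest∈ =
  subst (¬_ ∘ IsMinimalGenerator Λ) (m+[n∸m]≡n (≤-trans (m≤m+n (suc g) (suc g)) 2[1+g]≤x))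
    (sum⇒¬isMinimalGenerator (λ ()) (m<n⇒n≢0 (m+n≤o⇒m≤o∸n (suc g) 2[1+g]≤x)) 1+g∈ rest∈)

ordinary-isMinimalGenerator⇔ : ∀ g x → IsMinimalGenerator (ordinary g) x ⇔ (g < x × x < suc g + suc g)
ordinary-isMinimalGenerator⇔ g x = mk⇔ to from
  where
  to : IsMinimalGenerator (ordinary g) x → g < x × x < suc g + suc g
  to mg@(x≢0 , x∈ , _) with x <? suc g + suc g
  ... | yes x<2[1+g] = ordinary-nonzero⇒> x≢0 x∈ , x<2[1+g]
  ... | no  x≮2[1+g] = ⊥-elim (1+g+rest⇒¬isMinimalGenerator 2[1+g]≤x (inj₂ ≤-refl)
                         (inj₂ (m+n≤o⇒m≤o∸n (suc g) 2[1+g]≤x)) mg)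
    where 2[1+g]≤x = ≮⇒≥ x≮2[1+g]
  from : g < x × x < suc g + suc g → IsMinimalGenerator (ordinary g) x
  from (g<x , x<2[1+g]) = <2[1+g]⇒isMinimalGenerator id (m<n⇒n≢0 g<x) (inj₂ g<x) x<2[1+g]

remove-ordinary-isFrobenius : ∀ {g m} → g ≤ m → IsFrobenius (remove (ordinary g) m) m
remove-ordinary-isFrobenius {g} {m} g≤m = (λ (_ , m≢m) → m≢m refl) , below
  where
  below : ∀ n → ¬ remove (ordinary g) m n → n ≤ m
  below n n∉ with n ≤? m
  ... | yes n≤m = n≤m
  ... | no  n≰m = ⊥-elim (n∉ (inj₂ (≤-<-trans g≤m (≰⇒> n≰m)) , n≰m ∘ ≤-reflexive))

remove-ordinary-1+g⇔ordinary-1+g : ∀ g n → remove (ordinary g) (suc g) n ⇔ ordinary (suc g) n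
remove-ordinary-1+g⇔ordinary-1+g g n = mk⇔ to from
  where
  to : remove (ordinary g) (suc g) n → ordinary (suc g) n
  to (inj₁ n≡0 , _) = inj₁ n≡0
  to (inj₂ g<n , n≢1+g) = inj₂ (≤∧≢⇒< g<n (n≢1+g ∘ sym))
  from : ordinary (suc g) n → remove (ordinary g) (suc g) n
  from (inj₁ refl) = inj₁ refl , λ ()
  from (inj₂ 1+g<n) = inj₂ (<⇒≤ 1+g<n) , >⇒≢ 1+g<n

remove-ordinary-isMinimalGenerator : ∀ {g m x} → g ≤ m → m < x → x < suc g + suc g →
  IsMinimalGenerator (remove (ordinary g) m) x
remove-ordinary-isMinimalGenerator g≤m m<x x<2[1+g] =
  <2[1+g]⇒isMinimalGenerator proj₁ (m<n⇒n≢0 m<x) (inj₂ (≤-<-trans g≤m m<x) , >⇒≢ m<x) x<2[1+g]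

-- Above 2(g+1), only (g+1) + m can escape being written as (g+1) + (x − (g+1)).
remove-ordinary-isMinimalGenerator⇒ : ∀ {g m x} → suc g < m →
  IsMinimalGenerator (remove (ordinary g) m) x → x < suc g + suc g ⊎ x ≡ suc g + m
remove-ordinary-isMinimalGenerator⇒ {g} {m} {x} 1+g<m mg with x <? suc g + suc g | x ≟ suc g + m
... | yes x<2[1+g] | _      = inj₁ x<2[1+g]
... | no  _        | yes x≡ = inj₂ x≡
... | no  x≮2[1+g] | no  x≢ =
  ⊥-elim (1+g+rest⇒¬isMinimalGenerator 2[1+g]≤x (inj₂ ≤-refl , <⇒≢ 1+g<m) (inj₂ 1+g≤rest , rest≢m) mg)
  where
  2[1+g]≤x = ≮⇒≥ x≮2[1+g]
  1+g≤rest : suc g ≤ x ∸ suc g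
  1+g≤rest = m+n≤o⇒m≤o∸n (suc g) 2[1+g]≤x
  rest≢m : x ∸ suc g ≢ m
  rest≢m rest≡m = x≢ (trans (sym (m+[n∸m]≡n (≤-trans (m≤m+n (suc g) (suc g)) 2[1+g]≤x)))
                            (cong (suc g +_) rest≡m))

-- (g+1) + m = (g+2) + (m−1), and both summands survive once m > g + 2.
remove-ordinary-¬isMinimalGenerator : ∀ {g m} → suc (suc g) < m →
  ¬ IsMinimalGenerator (remove (ordinary g) m) (suc g + m)
remove-ordinary-¬isMinimalGenerator {g} {suc m} (s≤s 2+g≤m) =
  subst (¬_ ∘ IsMinimalGenerator (remove (ordinary g) (suc m))) (sym (+-suc (suc g) m))
    (sum⇒¬isMinimalGenerator (λ ()) (m<n⇒n≢0 2+g≤m)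
      (inj₂ (n≤1+n (suc g)) , <⇒≢ (s≤s 2+g≤m))
      (inj₂ (≤-trans (n≤1+n (suc g)) 2+g≤m) , <⇒≢ ≤-refl))

remove-ordinary-2+g-isMinimalGenerator : ∀ g →
  IsMinimalGenerator (remove (ordinary g) (suc (suc g))) (suc g + suc (suc g))
remove-ordinary-2+g-isMinimalGenerator g =
  (λ ()) , (inj₂ (m≤m+n (suc g) _) , >⇒≢ (s≤s (m≤n+m (suc (suc g)) g))) , indecomposable
  where
  x = suc g + suc (suc g)
  indecomposable : ∀ a b → a ≢ 0 → b ≢ 0 → remove (ordinary g) (suc (suc g)) a →
    remove (ordinary g) (suc (suc g)) b → a + b ≢ x
  indecomposable a b a≢0 b≢0 (a∈ , a≢2+g) (b∈ , b≢2+g) a+b≡x with a ≟ suc g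
  ... | yes refl = b≢2+g (+-cancelˡ-≡ (suc g) b (suc (suc g)) a+b≡x)
  ... | no  a≢1+g = 1+n≰n (subst (suc x ≤_) a+b≡x
          (subst (_≤ a + b) (cong (suc ∘ suc) (sym (+-suc g (suc g))))
            (+-mono-≤ 3+g≤a (ordinary-nonzero⇒> b≢0 b∈))))
    where
    3+g≤a : suc (suc (suc g)) ≤ a
    3+g≤a = ≤∧≢⇒< (≤∧≢⇒< (ordinary-nonzero⇒> a≢0 a∈) (a≢1+g ∘ sym)) (a≢2+g ∘ sym)

remove-ordinary-1+g-minGensAboveFrobenius : ∀ g →
  MinGensAboveFrobenius (remove (ordinary g) (suc g)) (suc (suc g))
remove-ordinary-1+g-minGensAboveFrobenius g =
  minGensAboveFrobenius-intro (remove-ordinary-isFrobenius (n≤1+n g)) bounds⇔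
    (subst (HasExactly _) (m+n∸m≡n (suc (suc g)) (suc (suc g)))
      (interval-HasExactly (suc (suc g)) (suc (suc g) + suc (suc g))))
  where
  open Equivalence
  bounds⇔ : ∀ x → (IsMinimalGenerator (remove (ordinary g) (suc g)) x × suc g < x) ⇔
                   (suc g < x × x < suc (suc g) + suc (suc g))
  bounds⇔ x = mk⇔
    (λ (mg , _) → to (ordinary-isMinimalGenerator⇔ (suc g) x)
                     (isMinimalGenerator-resp (remove-ordinary-1+g⇔ordinary-1+g g) mg))
    (λ bounds → isMinimalGenerator-resp (λ n → ⇔-sym (remove-ordinary-1+g⇔ordinary-1+g g n))
                  (from (ordinary-isMinimalGenerator⇔ (suc g) x) bounds) ,
                proj₁ bounds)

remove-ordinary-2+g-minGensAboveFrobenius : ∀ g →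
  MinGensAboveFrobenius (remove (ordinary g) (suc (suc g))) (suc (suc g + suc g ∸ suc (suc (suc g))))
remove-ordinary-2+g-minGensAboveFrobenius g =
  minGensAboveFrobenius-intro (remove-ordinary-isFrobenius g≤2+g) bounds⇔
    (HasExactly-∷ e∉interval (interval-HasExactly (suc (suc (suc g))) (suc g + suc g)))
  where
  g≤2+g = m≤n+m g 2
  e = suc g + suc (suc g)
  bounds⇔ : ∀ x → (IsMinimalGenerator (remove (ordinary g) (suc (suc g))) x × suc (suc g) < x) ⇔
                   (x ≡ e ⊎ (suc (suc g) < x × x < suc g + suc g))
  bounds⇔ x = mk⇔ to from
    where
    to : IsMinimalGenerator (remove (ordinary g) (suc (suc g))) x × suc (suc g) < x →
         x ≡ e ⊎ (suc (suc g) < x × x < suc g + suc g)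
    to (mg , 2+g<x) with remove-ordinary-isMinimalGenerator⇒ ≤-refl mg
    ... | inj₁ x<2[1+g] = inj₂ (2+g<x , x<2[1+g])
    ... | inj₂ x≡e      = inj₁ x≡e
    from : x ≡ e ⊎ (suc (suc g) < x × x < suc g + suc g) →
           IsMinimalGenerator (remove (ordinary g) (suc (suc g))) x × suc (suc g) < x
    from (inj₁ refl) = remove-ordinary-2+g-isMinimalGenerator g , s≤s (m≤n+m (suc (suc g)) g)
    from (inj₂ (2+g<x , x<2[1+g])) = remove-ordinary-isMinimalGenerator g≤2+g 2+g<x x<2[1+g] , 2+g<x
  e∉interval : ¬ (suc (suc g) < e × e < suc g + suc g)
  e∉interval (_ , e<2[1+g]) = <⇒≱ e<2[1+g] (+-monoʳ-≤ (suc g) (n≤1+n (suc g)))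

remove-ordinary-minGensAboveFrobenius : ∀ {g m} → suc (suc g) < m →
  MinGensAboveFrobenius (remove (ordinary g) m) (suc g + suc g ∸ suc m)
remove-ordinary-minGensAboveFrobenius {g} {m} 2+g<m =
  minGensAboveFrobenius-intro (remove-ordinary-isFrobenius g≤m) bounds⇔
    (interval-HasExactly (suc m) (suc g + suc g))
  where
  g≤m = ≤-trans (m≤n+m g 3) 2+g<m
  bounds⇔ : ∀ x → (IsMinimalGenerator (remove (ordinary g) m) x × m < x) ⇔ (m < x × x < suc g + suc g)
  bounds⇔ x = mk⇔ to from
    where
    to : IsMinimalGenerator (remove (ordinary g) m) x × m < x → m < x × x < suc g + suc g
    to (mg , m<x) with remove-ordinary-isMinimalGenerator⇒ (≤-trans (n≤1+n _) 2+g<m) mg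
    ... | inj₁ x<2[1+g] = m<x , x<2[1+g]
    ... | inj₂ refl     = ⊥-elim (remove-ordinary-¬isMinimalGenerator 2+g<m mg)
    from : m < x × x < suc g + suc g → IsMinimalGenerator (remove (ordinary g) m) x × m < x
    from (m<x , x<2[1+g]) = remove-ordinary-isMinimalGenerator g≤m m<x x<2[1+g] , m<x

<2[1+n]⇔≤2n+1 : ∀ n {x} → x < suc n + suc n ⇔ x ≤ n + n + 1
<2[1+n]⇔≤2n+1 n {x} = mk⇔ (λ x<2[1+n] → ≤-pred (subst (x <_) 2[1+n]≡1+[2n+1] x<2[1+n]))
                           (λ x≤2n+1 → subst (x <_) (sym 2[1+n]≡1+[2n+1]) (s≤s x≤2n+1))
  where
  2[1+n]≡1+[2n+1] : suc n + suc n ≡ suc (n + n + 1)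
  2[1+n]≡1+[2n+1] = cong suc (trans (+-suc n n) (+-comm 1 (n + n)))

lemma4 : (g : ℕ) →
    IsNumericalSemigroup (ordinary g) ×
    (∀ x → IsMinimalGenerator (ordinary g) x ⇔ (suc g ≤ x × x ≤ g + g + 1)) ×
    MinGensAboveFrobenius (remove (ordinary g) (g + 1)) (g + 2) ×
    (1 ≤ g → MinGensAboveFrobenius (remove (ordinary g) (g + 2)) g) ×
    (∀ r → 2 < r → r ≤ g + 1 →
      MinGensAboveFrobenius (remove (ordinary g) (g + r)) (suc g ∸ r))
lemma4 g =
  ordinary-isNumericalSemigroup g ,
  (λ x → ⇔-trans (ordinary-isMinimalGenerator⇔ g x) (⇔-refl ×-⇔ <2[1+n]⇔≤2n+1 g)) ,
  subst₂ (MinGensAboveFrobenius ∘ remove (ordinary g)) (+-comm 1 g) (+-comm 2 g)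
    (remove-ordinary-1+g-minGensAboveFrobenius g) ,
  2+g-case ,
  λ r 2<r _ → subst (MinGensAboveFrobenius (remove (ordinary g) (g + r)))
    ([m+n]∸[m+o]≡n∸o (suc g) (suc g) r)
    (remove-ordinary-minGensAboveFrobenius (subst (_≤ g + r) (+-comm g 3) (+-monoʳ-≤ g 2<r)))
  where
  2+g-case : ∀ {n} → 1 ≤ n → MinGensAboveFrobenius (remove (ordinary n) (n + 2)) n
  2+g-case {suc h} _ = subst₂ (MinGensAboveFrobenius ∘ remove (ordinary (suc h))) (+-comm 2 (suc h))
    (cong suc (m+n∸n≡m h (suc (suc h)))) (remove-ordinary-2+g-minGensAboveFrobenius (suc h))
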